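{- Let $n\ge1$ and let $\mathrm{dec}_n=n(n-1)\cdots1$. The map $\Psi_{\mathrm{Sub}\to\mathrm{PF}}$ restricts to a bijection from the set $\mathrm{NonCross}_n$ of non-crossing matchings on $[n]$ to the fibre $\mathcal{O}^{ -1}_{\mathrm{MVP}_n}(\mathrm{dec}_n)$.
   Context: $[n]=\{1,\dots,n\}$. In the MVP parking process for a preference $p\in[n]^n$, cars $1,\dots,n$ enter in order a one-way street with spots $1,\dots,n$; car $i$ parks in spot $p_i$, and if $p_i$ was occupied by an earlier car $j$, car $j$ is bumped and parks in the first unoccupied spot $k>p_i$ (bumped cars do not bump others). $p$ is an MVP parking function if all cars park. The outcome $\mathcal{O}_{\mathrm{MVP}_n}(p)$ is the permutation $\pi$ with $\pi_i$ the car in spot $i$ at the end, and $\mathcal{O}^{ -1}_{\mathrm{MVP}_n}(\pi)$ is the set of MVP parking functions with outcome $\pi$. An arc diagram on $[n]$ is a set of pairs $(j,i)$ with $1\le j<i\le n$. For an arc diagram $\Delta$ in which each $i$ has at most one $j$ with $(j,i)\in\Delta$, $\Psi_{\mathrm{Sub}\to\mathrm{PF}}(\Delta)$ is the preference $p$ defined by: for each $i\in[n]$, $p_{n+1-i}=j$ if $(j,i)\in\Delta$, and $p_{n+1-i}=i$ if no such $j$ exists. A non-crossing matching is an arc diagram $\Delta$ such that every vertex of $[n]$ lies in at most one arc of $\Delta$, and there are no $i<j<k<\ell$ with $(i,k),(j,\ell)\in\Delta$. -}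

module Defs where

open import Data.Nat using (ℕ; zero; suc; _<_; _≤_; _∸_)
open import Data.Bool using (Bool; true; false; if_then_else_)
open import Data.Maybe using (Maybe; just; nothing; fromMaybe)
open import Data.List using (List; []; _∷_; map; upTo; replicate)
open import Data.List.Relation.Unary.All using (All)
open import Data.List.Membership.Propositional using (_∈_)
open import Data.Vec as Vec using (Vec; toList; tabulate)
open import Data.Fin using (Fin; toℕ)
open import Data.Product using (_×_)
open import Data.Sum using (_⊎_)
open import Data.Empty using (⊥)
open import Relation.Binary.PropositionalEquality using (_≡_)

-- MVP parking process.  Spots and cars are 1-indexed natural numbers.
-- A street is the list of spots 1..n (list position 0 = spot 1);
-- 'nothing' = unoccupied, 'just c' = occupied by car c.

Street : Set
Street = List (Maybe ℕ)

settle : ℕ → Street → Street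
settle c []             = []
settle c (nothing ∷ r)  = just c ∷ r
settle c (just k ∷ r)   = just k ∷ settle c r

-- car i arrives preferring spot (suc s): it parks there; an occupant j
-- is bumped to the first unoccupied spot k > p_i.
-- (Preferences outside [1,n] never occur for the preferences considered;
-- such a car simply does not park.)
arriveAt : ℕ → ℕ → Street → Street
arriveAt i _       []             = []
arriveAt i zero    (nothing ∷ r)  = just i ∷ r
arriveAt i zero    (just j ∷ r)   = just i ∷ settle j r
arriveAt i (suc k) (x ∷ r)        = x ∷ arriveAt i k r

arrive : ℕ → ℕ → Street → Street
arrive i zero    st = st
arrive i (suc s) st = arriveAt i s st

runFrom : ℕ → List ℕ → Street → Street
runFrom c []       st = st
runFrom c (x ∷ xs) st = runFrom (suc c) xs (arrive c x st)

finalStreet : (n : ℕ) → Vec ℕ n → Street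
finalStreet n p = runFrom 1 (toList p) (replicate n nothing)

IsPreference : (n : ℕ) → Vec ℕ n → Set
IsPreference n p = All (λ x → 1 ≤ x × x ≤ n) (toList p)

IsMVPParkingFunction : (n : ℕ) → Vec ℕ n → Set
IsMVPParkingFunction n p =
  IsPreference n p × All (λ c → just c ∈ finalStreet n p) (map suc (upTo n))

dec : ℕ → List ℕ
dec zero    = []
dec (suc n) = suc n ∷ dec n

InDecFibre : (n : ℕ) → Vec ℕ n → Set
InDecFibre n p = IsMVPParkingFunction n p × finalStreet n p ≡ map just (dec n)

-- Arc diagrams on [n], encoded as n×n Boolean matrices:
-- (j,i) ∈ Δ  iff  the entry in row j, column i (1-indexed) is true.

ArcDiagram : ℕ → Set
ArcDiagram n = Vec (Vec Bool n) n

nth : {A : Set} → ℕ → List A → Maybe A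
nth _       []       = nothing
nth zero    (x ∷ _)  = just x
nth (suc k) (_ ∷ xs) = nth k xs

-- arc Δ j i = true iff (j,i) ∈ Δ  (false for indices outside [n])
arc : {n : ℕ} → ArcDiagram n → ℕ → ℕ → Bool
arc Δ (suc j) (suc i) with nth j (toList Δ)
... | nothing  = false
... | just row = fromMaybe false (nth i (toList row))
arc Δ _ _ = false

IsArcDiagram : {n : ℕ} → ArcDiagram n → Set
IsArcDiagram Δ = ∀ j i → arc Δ j i ≡ true → j < i

IsNonCrossingMatching : {n : ℕ} → ArcDiagram n → Set
IsNonCrossingMatching Δ =
  IsArcDiagram Δ
  × (∀ j i j' i' v → arc Δ j i ≡ true → arc Δ j' i' ≡ true →
       (v ≡ j ⊎ v ≡ i) → (v ≡ j' ⊎ v ≡ i') → j ≡ j' × i ≡ i')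
  × (∀ a b c d → a < b → b < c → c < d →
       arc Δ a c ≡ true → arc Δ b d ≡ true → ⊥)

firstArcTo : {n : ℕ} → ArcDiagram n → ℕ → List ℕ → Maybe ℕ
firstArcTo Δ i []       = nothing
firstArcTo Δ i (j ∷ js) = if arc Δ j i then just j else firstArcTo Δ i js

partner : {n : ℕ} → ArcDiagram n → ℕ → ℕ
partner {n} Δ i = fromMaybe i (firstArcTo Δ i (map suc (upTo n)))

-- Ψ_{Sub→PF}: p_{n+1-i} = partner(i); position k (0-indexed) is n+1-i
-- with i = n - k.
Ψ : {n : ℕ} → ArcDiagram n → Vec ℕ n
Ψ {n} Δ = tabulate (λ (k : Fin n) → partner Δ (n ∸ toℕ k))

module Submission where

-- Car n+1-t enters at stage t = n, …, 1, and dec_n wants it in spot t; call its preference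
-- q t, so that Ψ Δ has q = partner Δ. Reading q t < t as an arc (q t, t), the fibre of dec_n
-- consists exactly of the q with 1 ≤ q t ≤ t whose arcs are nested and pairwise vertex
-- disjoint, i.e. the partner functions of non-crossing matchings. For such q the run is
-- followed stage by stage: car n+1-t parks at q t, and when the owner of spot q t arrives it
-- is bumped exactly home, because nesting keeps every spot strictly inside the arc occupied.
-- Conversely, bumped cars only move right into the first vacancy, so a run ending in dec_n
-- passes through configurations satisfying a backward invariant, and each stage of it
-- forces the nesting condition for the arriving car.

open import Defs
open import Data.Bool using (true; false)
open import Data.Bool.Properties using (⇔→≡)
open import Data.Empty using (⊥; ⊥-elim)
open import Data.Fin using (Fin; zero; suc; toℕ)
open import Data.Fin.Properties using (toℕ<n)
open import Data.List using (List; []; _∷_; length; replicate; map; upTo; drop)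
open import Data.List.Membership.Propositional using (_∈_)
open import Data.List.Membership.Propositional.Properties using (∈-map⁺; ∈-map⁻; ∈-upTo⁺; ∈-upTo⁻)
open import Data.List.Properties using (length-replicate; length-map; length-drop; drop-all)
open import Data.List.Relation.Unary.All as All using (All; []; _∷_)
open import Data.List.Relation.Unary.Any using (here; there)
open import Data.Maybe using (Maybe; just; nothing; fromMaybe)
open import Data.Maybe.Properties using (just-injective)
open import Data.Nat
open import Data.Nat.Properties
open import Data.Product using (∃-syntax; _×_; _,_; proj₁; proj₂)
open import Data.Sum using (_⊎_; inj₁; inj₂)
open import Data.Vec using (Vec; _∷_; toList; tabulate; lookup)
open import Data.Vec.Properties using (length-toList; tabulate∘lookup; tabulate-cong; lookup∘tabulate)
open import Function using (_∘_; case_of_)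
open import Function.Bundles using (_⇔_; mk⇔; Equivalence)
open import Function.Properties.Equivalence using () renaming (sym to ⇔-sym; trans to ⇔-trans)
open import Relation.Binary.Definitions using (tri<; tri≈; tri>)
open import Relation.Binary.PropositionalEquality
open import Relation.Nullary using (¬_; Dec; yes; no; does)
open import Relation.Nullary.Decidable using (_×-dec_)

≢suc⇒suc< : ∀ {i s} → i < s → s ≢ suc i → suc i < s
≢suc⇒suc< i<s s≢ = ≤∧≢⇒< i<s (≢-sym s≢)

≢suc⇒≤ : ∀ {s i} → s ≤ suc i → s ≢ suc i → s ≤ i
≢suc⇒≤ s≤i s≢ = s≤s⁻¹ (≤∧≢⇒< s≤i s≢)

≤⇒≢suc : ∀ {s i} → s ≤ i → s ≢ suc i
≤⇒≢suc s≤i = <⇒≢ (s≤s s≤i)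

nth-bound : ∀ {A : Set} (xs : List A) j {x} → nth j xs ≡ just x → j < length xs
nth-bound (y ∷ ys) zero    _ = s≤s z≤n
nth-bound (y ∷ ys) (suc j) e = s≤s (nth-bound ys j e)

nth-lookup : ∀ {A : Set} {m} (v : Vec A m) (k : Fin m) → nth (toℕ k) (toList v) ≡ just (lookup v k)
nth-lookup (x ∷ v) zero    = refl
nth-lookup (x ∷ v) (suc k) = nth-lookup v k

nth-toList-tabulate : ∀ {A : Set} {m} (g : ℕ → A) j → j < m → nth j (toList (tabulate {n = m} (g ∘ toℕ))) ≡ just (g j)
nth-toList-tabulate {m = suc m} g zero    _         = refl
nth-toList-tabulate {m = suc m} g (suc j) (s≤s j<m) = nth-toList-tabulate (g ∘ suc) j j<m

lookup-ext : ∀ {A : Set} {m} {u v : Vec A m} → (∀ k → lookup u k ≡ lookup v k) → u ≡ v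
lookup-ext {u = u} {v} same = trans (sym (tabulate∘lookup u)) (trans (tabulate-cong same) (tabulate∘lookup v))

All-toList-tabulate : ∀ {A : Set} {P : A → Set} {m} (f : Fin m → A) → (∀ k → P (f k)) → All P (toList (tabulate f))
All-toList-tabulate {m = zero}  f all = []
All-toList-tabulate {m = suc m} f all = all zero ∷ All-toList-tabulate (f ∘ suc) (all ∘ suc)

drop-∷ : ∀ {A : Set} (d : A) m xs → m < length xs → drop m xs ≡ fromMaybe d (nth m xs) ∷ drop (suc m) xs
drop-∷ d zero    (x ∷ xs) _        = refl
drop-∷ d (suc m) (x ∷ xs) (s≤s m<) = drop-∷ d m xs m<

does⇔ : ∀ {P : Set} (p? : Dec P) → does p? ≡ true ⇔ P
does⇔ (yes p) = mk⇔ (λ _ → p) (λ _ → refl)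
does⇔ (no ¬p) = mk⇔ (λ ()) (⊥-elim ∘ ¬p)

length-dec : ∀ m → length (dec m) ≡ m
length-dec zero    = refl
length-dec (suc m) = cong suc (length-dec m)

∈-dec : ∀ {m c} → 1 ≤ c → c ≤ m → c ∈ dec m
∈-dec {zero}  1≤c c≤0 = ⊥-elim (<⇒≱ 1≤c c≤0)
∈-dec {suc m} {c} 1≤c c≤m with c ≟ suc m
... | yes refl = here refl
... | no c≢ = there (∈-dec 1≤c (s≤s⁻¹ (≤∧≢⇒< c≤m c≢)))

-- spots are 1-indexed; spot 0 and spots past the end read as vacant
spot : Street → ℕ → Maybe ℕ
spot st       zero          = nothing
spot []       (suc s)       = nothing
spot (y ∷ r)  (suc zero)    = y
spot (y ∷ r)  (suc (suc s)) = spot r (suc s)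

spot-∷ : ∀ y r {f} → 0 < f → spot (y ∷ r) (suc f) ≡ spot r f
spot-∷ y r {suc f} _ = refl

spot-∷-head : ∀ {y y'} r t → t ≢ 1 → spot (y ∷ r) t ≡ spot (y' ∷ r) t
spot-∷-head r zero          _ = refl
spot-∷-head r (suc zero)    h = ⊥-elim (h refl)
spot-∷-head r (suc (suc t)) _ = refl

spot-replicate : ∀ m s → spot (replicate m nothing) s ≡ nothing
spot-replicate m       zero          = refl
spot-replicate zero    (suc s)       = refl
spot-replicate (suc m) (suc zero)    = refl
spot-replicate (suc m) (suc (suc s)) = spot-replicate m (suc s)

spot-beyond : ∀ st s → length st < s → spot st s ≡ nothing
spot-beyond []      (suc s)       _          = refl
spot-beyond (y ∷ r) (suc (suc s)) (s≤s r<s) = spot-beyond r (suc s) r<s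

spot-ext : ∀ a b → length a ≡ length b → (∀ s → spot a s ≡ spot b s) → a ≡ b
spot-ext []      []       _   _    = refl
spot-ext (y ∷ r) (y' ∷ r') len same =
  cong₂ _∷_ (same 1) (spot-ext r r' (suc-injective len) λ { zero → refl ; (suc s) → same (suc (suc s)) })

spot-dec : ∀ m s → 1 ≤ s → s ≤ m → spot (map just (dec m)) s ≡ just (suc (m ∸ s))
spot-dec (suc m) (suc zero)    _ _         = refl
spot-dec (suc m) (suc (suc s)) _ (s≤s s≤m) = spot-dec m (suc s) (s≤s z≤n) s≤m

vacant≢occupied : ∀ {a : Maybe ℕ} {x} → a ≡ nothing → a ≡ just x → ⊥
vacant≢occupied refl ()

record FirstVacancy (st : Street) (K f : ℕ) : Set where
  field
    after          : K < f
    inStreet       : f ≤ length st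
    vacant         : spot st f ≡ nothing
    occupiedBefore : ∀ t → K < t → t < f → spot st t ≢ nothing

positive : ∀ {st K f} → FirstVacancy st K f → 0 < f
positive v = ≤-<-trans z≤n (FirstVacancy.after v)

FullAfter : Street → ℕ → Set
FullAfter st K = ∀ t → K < t → t ≤ length st → spot st t ≢ nothing

vacancy-∷ : ∀ {y r K f} → FirstVacancy r K f → FirstVacancy (y ∷ r) (suc K) (suc f)
vacancy-∷ {f = suc f} v = record
  { after          = s≤s after
  ; inStreet       = s≤s inStreet
  ; vacant         = vacant
  ; occupiedBefore = λ { (suc (suc t)) (s≤s K<t) (s≤s t<f) → occupiedBefore (suc t) K<t t<f }
  }
  where open FirstVacancy v

full-∷ : ∀ {y r K} → FullAfter r K → FullAfter (y ∷ r) (suc K)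
full-∷ full (suc (suc t)) (s≤s K<t) (s≤s t≤) = full (suc t) K<t t≤

full-∷⁻ : ∀ {y r} K → FullAfter (y ∷ r) K → FullAfter r (pred K)
full-∷⁻ zero    full (suc t) _   t≤ = full (suc (suc t)) z<s (s≤s t≤)
full-∷⁻ (suc K) full (suc t) K<t t≤ = full (suc (suc t)) (s≤s K<t) (s≤s t≤)

unchanged-∷ : ∀ y {r r' K} → (∀ t → t ≢ K → spot r' t ≡ spot r t) →
              ∀ t → t ≢ suc K → spot (y ∷ r') t ≡ spot (y ∷ r) t
unchanged-∷ y oth zero          _ = refl
unchanged-∷ y oth (suc zero)    _ = refl
unchanged-∷ y oth (suc (suc t)) h = oth (suc t) (h ∘ cong suc)

unchanged₂-∷ : ∀ y {r r' K f} → (∀ t → t ≢ K → t ≢ f → spot r' t ≡ spot r t) →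
               ∀ t → t ≢ suc K → t ≢ suc f → spot (y ∷ r') t ≡ spot (y ∷ r) t
unchanged₂-∷ y oth zero          _ _ = refl
unchanged₂-∷ y oth (suc zero)    _ _ = refl
unchanged₂-∷ y oth (suc (suc t)) h h' = oth (suc t) (h ∘ cong suc) (h' ∘ cong suc)

data Settling (x : ℕ) (r : Street) : Street → Set where
  settlesAt : ∀ {r'} f → FirstVacancy r 0 f → spot r' f ≡ just x →
              (∀ t → t ≢ f → spot r' t ≡ spot r t) → Settling x r r'
  drivesOff : FullAfter r 0 → Settling x r r

settling : ∀ x r → Settling x r (settle x r)
settling x [] = drivesOff λ t 0<t t≤0 _ → <⇒≱ 0<t t≤0
settling x (nothing ∷ r) = settlesAt 1 first refl (spot-∷-head r)
  where
  first : FirstVacancy (nothing ∷ r) 0 1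
  first = record { after = s≤s z≤n ; inStreet = s≤s z≤n ; vacant = refl
                 ; occupiedBefore = λ t 0<t t<1 → ⊥-elim (<⇒≱ 0<t (s≤s⁻¹ t<1)) }
settling x (just k ∷ r) with settle x r | settling x r
... | r' | settlesAt f v e oth =
  settlesAt (suc f) first (trans (spot-∷ (just k) r' (positive v)) e) (unchanged-∷ (just k) oth)
  where
  first : FirstVacancy (just k ∷ r) 0 (suc f)
  first = record
    { after          = s≤s z≤n
    ; inStreet       = s≤s inStreet
    ; vacant         = FirstVacancy.vacant (vacancy-∷ v)
    ; occupiedBefore = λ { (suc zero) _ _ () ; (suc (suc t)) _ (s≤s t<f) → occupiedBefore (suc t) (s≤s z≤n) t<f } }
    where open FirstVacancy v
... | .r | drivesOff full = drivesOff (λ { (suc zero) _ _ () ; (suc (suc t)) _ (s≤s t≤) → full (suc t) (s≤s z≤n) t≤ })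

data Arrival (st st' : Street) (K : ℕ) : Set where
  intoVacant : spot st K ≡ nothing → (∀ t → t ≢ K → spot st' t ≡ spot st t) → Arrival st st' K
  bumps      : ∀ x f → spot st K ≡ just x → FirstVacancy st K f → spot st' f ≡ just x →
               (∀ t → t ≢ K → t ≢ f → spot st' t ≡ spot st t) → Arrival st st' K
  bumpsOff   : ∀ x → spot st K ≡ just x → FullAfter st K →
               (∀ t → t ≢ K → spot st' t ≡ spot st t) → Arrival st st' K

arrival-∷ : ∀ y {r r' K} → Arrival r r' (suc K) → Arrival (y ∷ r) (y ∷ r') (suc (suc K))
arrival-∷ y (intoVacant e oth)       = intoVacant e (unchanged-∷ y oth)
arrival-∷ y {r' = r'} (bumps x f e v e' oth) =
  bumps x (suc f) e (vacancy-∷ v) (trans (spot-∷ y r' (positive v)) e') (unchanged₂-∷ y oth)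
arrival-∷ y (bumpsOff x e full oth)  = bumpsOff x e (full-∷ full) (unchanged-∷ y oth)

arriving : ∀ c k st → k < length st →
           spot (arriveAt c k st) (suc k) ≡ just c × Arrival st (arriveAt c k st) (suc k)
arriving c zero (nothing ∷ r) _ = refl , intoVacant refl (spot-∷-head r)
arriving c zero (just j ∷ r)  _ with settle j r | settling j r
... | r' | settlesAt f v e oth =
  refl , bumps j (suc f) refl (vacancy-∷ v) (trans (spot-∷ (just c) r' (positive v)) e)
               (λ t h h' → trans (spot-∷-head r' t h) (unchanged-∷ (just j) oth t h'))
... | .r | drivesOff full = refl , bumpsOff j refl (full-∷ full) (spot-∷-head r)
arriving c (suc k) (y ∷ r) (s≤s k<) with arriving c k r k<
... | e , a = e , arrival-∷ y a

arrival-vacant : ∀ {st st' K} → Arrival st st' K → spot st K ≡ nothing →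
                 ∀ t → t ≢ K → spot st' t ≡ spot st t
arrival-vacant (intoVacant _ unchanged) _ = unchanged
arrival-vacant (bumps _ _ e _ _ _)      v = ⊥-elim (vacant≢occupied v e)
arrival-vacant (bumpsOff _ e _ _)       v = ⊥-elim (vacant≢occupied v e)

length-settle : ∀ x r → length (settle x r) ≡ length r
length-settle x []            = refl
length-settle x (nothing ∷ r) = refl
length-settle x (just k ∷ r)  = cong suc (length-settle x r)

length-arriveAt : ∀ c k st → length (arriveAt c k st) ≡ length st
length-arriveAt c k       []            = refl
length-arriveAt c zero    (nothing ∷ r) = refl
length-arriveAt c zero    (just j ∷ r)  = cong suc (length-settle j r)
length-arriveAt c (suc k) (x ∷ r)       = cong suc (length-arriveAt c k r)

length-arrive : ∀ c x st → length (arrive c x st) ≡ length st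
length-arrive c zero    st = refl
length-arrive c (suc x) st = length-arriveAt c x st

occupancy : Street → ℕ
occupancy []            = 0
occupancy (nothing ∷ r) = occupancy r
occupancy (just _ ∷ r)  = suc (occupancy r)

occupancy-settle : ∀ x r → occupancy (settle x r) ≤ suc (occupancy r)
occupancy-settle x []            = z≤n
occupancy-settle x (nothing ∷ r) = ≤-refl
occupancy-settle x (just k ∷ r)  = s≤s (occupancy-settle x r)

occupancy-arriveAt : ∀ c k st → occupancy (arriveAt c k st) ≤ suc (occupancy st)
occupancy-arriveAt c k       []            = z≤n
occupancy-arriveAt c zero    (nothing ∷ r) = ≤-refl
occupancy-arriveAt c zero    (just j ∷ r)  = s≤s (occupancy-settle j r)
occupancy-arriveAt c (suc k) (nothing ∷ r) = occupancy-arriveAt c k r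
occupancy-arriveAt c (suc k) (just j ∷ r)  = s≤s (occupancy-arriveAt c k r)

occupancy-arrive : ∀ c x st → occupancy (arrive c x st) ≤ suc (occupancy st)
occupancy-arrive c zero    st = n≤1+n _
occupancy-arrive c (suc x) st = occupancy-arriveAt c x st

occupancy-∷ : ∀ y r → occupancy r ≤ occupancy (y ∷ r)
occupancy-∷ nothing  r = ≤-refl
occupancy-∷ (just _) r = n≤1+n _

occupancy-full : ∀ st m → FullAfter st m → length st ∸ m ≤ occupancy st
occupancy-full []            m       _    = ≤-reflexive (0∸n≡0 m)
occupancy-full (nothing ∷ r) zero    full = ⊥-elim (full 1 (s≤s z≤n) (s≤s z≤n) refl)
occupancy-full (just x ∷ r)  zero    full = s≤s (occupancy-full r zero (full-∷⁻ _ full))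
occupancy-full (y ∷ r)       (suc m) full = ≤-trans (occupancy-full r m (full-∷⁻ _ full)) (occupancy-∷ y r)

occupancy-replicate : ∀ m → occupancy (replicate m nothing) ≡ 0
occupancy-replicate zero    = refl
occupancy-replicate (suc m) = occupancy-replicate m

module Parking (n : ℕ) where

  -- car n+1-t, the car dec_n leaves in spot t
  owner : ℕ → ℕ
  owner t = suc (n ∸ t)

  owner-injective : ∀ {a b} → a ≤ n → b ≤ n → owner a ≡ owner b → a ≡ b
  owner-injective a≤n b≤n eq = ∸-cancelˡ-≡ a≤n b≤n (suc-injective eq)

  owner-decreasing : ∀ {a b} → a < b → b ≤ n → owner b < owner a
  owner-decreasing a<b b≤n = s≤s (∸-monoʳ-< a<b b≤n)

  owner-reflects-< : ∀ {a b} → owner a < owner b → b < a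
  owner-reflects-< {a} {b} lt = ≰⇒> λ a≤b → <⇒≱ lt (s≤s (∸-monoʳ-≤ n a≤b))

  owner-suc : ∀ {i} → i < n → suc (owner (suc i)) ≡ owner i
  owner-suc i<n = cong suc (sym (+-∸-assoc 1 i<n))

  Bounded : (ℕ → ℕ) → ℕ → Set
  Bounded q i = ∀ r → i < r → r ≤ n → 1 ≤ q r × q r ≤ r

  -- q t < t encodes the arc (q t, t); no later arc may start inside [q t, t]
  Nested : (ℕ → ℕ) → ℕ → Set
  Nested q i = ∀ t r → i < t → t < r → r ≤ n → q t < t → q t ≤ q r → q r ≤ t → ⊥

  Nested-weaken : ∀ {q i j} → i ≤ j → Nested q i → Nested q j
  Nested-weaken i≤j nested t r j<t = nested t r (≤-<-trans i≤j j<t)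

  Nested⇒leftEnds-distinct : ∀ {q i t r} → Nested q i → i < t → i < r → t ≤ n → r ≤ n →
                              q t < t → q r < r → q t ≡ q r → t ≡ r
  Nested⇒leftEnds-distinct {q} {i} {t} {r} nested i<t i<r t≤n r≤n qt<t qr<r eq with <-cmp t r
  ... | tri< t<r _ _ = ⊥-elim (nested t r i<t t<r r≤n qt<t (≤-reflexive eq) (≤-trans (≤-reflexive (sym eq)) (<⇒≤ qt<t)))
  ... | tri≈ _ t≡r _ = t≡r
  ... | tri> _ _ r<t = ⊥-elim (nested r t i<r r<t t≤n qr<r (≤-reflexive (sym eq)) (≤-trans (≤-reflexive eq) (<⇒≤ qr<r)))

  Agree : (ℕ → ℕ) → (ℕ → ℕ) → Set
  Agree q q' = ∀ t → 1 ≤ t → t ≤ n → q t ≡ q' t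

  Bounded-cong : ∀ {q q'} → Agree q q' → Bounded q 0 → Bounded q' 0
  Bounded-cong agree bounded r 0<r r≤n rewrite sym (agree r 0<r r≤n) = bounded r 0<r r≤n

  Nested-cong : ∀ {q q'} → Agree q q' → Nested q 0 → Nested q' 0
  Nested-cong agree nested t r 0<t t<r r≤n
    rewrite sym (agree t 0<t (<⇒≤ (<-≤-trans t<r r≤n))) | sym (agree r (<-trans 0<t t<r) r≤n) =
    nested t r 0<t t<r r≤n

  Claimed : (ℕ → ℕ) → ℕ → ℕ → Set
  Claimed q i s = ∃[ r ] (i < r × r ≤ n × q r ≡ s)

  claimed? : ∀ q i s → Dec (Claimed q i s)
  claimed? q i s with anyUpTo? (λ r → (i <? r) ×-dec (q r ≟ s)) (suc n)
  ... | yes (r , s≤s r≤n , i<r , e) = yes (r , i<r , r≤n , e)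
  ... | no none                     = no λ (r , i<r , r≤n , e) → none (r , s≤s r≤n , i<r , e)

  -- The street once the owners of spots i+1..n have arrived: owner r waits at q r until
  -- the owner of spot q r arrives and bumps it home.
  record Expected (q : ℕ → ℕ) (st : Street) (i : ℕ) : Set where
    field
      length≡   : length st ≡ n
      vacantHi  : ∀ s → i < s → s ≤ n → q s ≤ i → spot st s ≡ nothing
      ownedHi   : ∀ s → i < s → s ≤ n → i < q s → spot st s ≡ just (owner s)
      waitingLo : ∀ s r → 1 ≤ s → s ≤ i → i < r → r ≤ n → q r ≡ s → spot st s ≡ just (owner r)
      vacantLo  : ∀ s → 1 ≤ s → s ≤ i → ¬ Claimed q i s → spot st s ≡ nothing

  Vacant : Street → ℕ → ℕ → Set
  Vacant st K i = K < i → ∀ s → K ≤ s → s ≤ i → spot st s ≡ nothing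

  Nested⇒Vacant : ∀ {q st i} → suc i ≤ n → Expected q st (suc i) → Nested q i → 1 ≤ q (suc i) →
                  Vacant st (q (suc i)) (suc i)
  Nested⇒Vacant {q} {st} {i} i<n E nested 1≤K K<i s K≤s s≤i with claimed? q (suc i) s
  ... | no unclaimed = Expected.vacantLo E s (≤-trans 1≤K K≤s) s≤i unclaimed
  ... | yes (r , i<r , r≤n , qr≡s) =
    ⊥-elim (nested (suc i) r ≤-refl i<r r≤n K<i
              (≤-trans K≤s (≤-reflexive (sym qr≡s))) (≤-trans (≤-reflexive qr≡s) s≤i))

  Vacant⇒Nested : ∀ {q st i} → Expected q st (suc i) → Nested q (suc i) → 1 ≤ q (suc i) →
                  Vacant st (q (suc i)) (suc i) → Nested q i
  Vacant⇒Nested {q} {st} {i} E nested 1≤K vacant t r i<t t<r r≤n qt<t K≤qr qr≤t with t ≟ suc i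
  ... | no t≢ = nested t r (≤∧≢⇒< i<t (≢-sym t≢)) t<r r≤n qt<t K≤qr qr≤t
  ... | yes refl = vacant≢occupied (vacant qt<t (q r) K≤qr qr≤t)
                     (Expected.waitingLo E (q r) r (≤-trans 1≤K K≤qr) qr≤t t<r r≤n refl)

  unclaimed-suc : ∀ {q i s} → ¬ Claimed q i s → ¬ Claimed q (suc i) s
  unclaimed-suc unclaimed (r , i<r , r≤n , e) = unclaimed (r , <⇒≤ i<r , r≤n , e)

  module _ {q : ℕ → ℕ} {st : Street} {i : ℕ} (i<n : suc i ≤ n) (E : Expected q st (suc i)) where
    open Expected E

    private
      i<length : suc i ≤ length st
      i<length = subst (suc i ≤_) (sym length≡) i<n

    arrive-below : ∀ {k} → q (suc i) ≡ suc k → suc k < suc i → Vacant st (suc k) (suc i) →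
                   Expected q (arriveAt (owner (suc i)) k st) i
    arrive-below {k} qi≡K K<i vacant = record
      { length≡ = trans (length-arriveAt _ k st) length≡
      ; vacantHi = vacantHi' ; ownedHi = ownedHi' ; waitingLo = waitingLo' ; vacantLo = vacantLo' }
      where
      st' : Street
      st' = arriveAt (owner (suc i)) k st

      step : spot st' (suc k) ≡ just (owner (suc i)) × Arrival st st' (suc k)
      step = arriving (owner (suc i)) k st (≤-trans (<⇒≤ K<i) i<length)

      vacantK : spot st (suc k) ≡ nothing
      vacantK = vacant K<i (suc k) ≤-refl (<⇒≤ K<i)

      vacantI : spot st (suc i) ≡ nothing
      vacantI = vacant K<i (suc i) (<⇒≤ K<i) ≤-refl

      unchanged : ∀ t → t ≢ suc k → spot st' t ≡ spot st t
      unchanged = arrival-vacant (proj₂ step) vacantK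

      vacantHi' : ∀ s → i < s → s ≤ n → q s ≤ i → spot st' s ≡ nothing
      vacantHi' s i<s s≤n qs≤i with s ≟ suc i
      ... | yes refl = trans (unchanged (suc i) (>⇒≢ K<i)) vacantI
      ... | no s≢ = trans (unchanged s (>⇒≢ (<-trans K<i (≢suc⇒suc< i<s s≢))))
                          (vacantHi s (≢suc⇒suc< i<s s≢) s≤n (m≤n⇒m≤1+n qs≤i))

      ownedHi' : ∀ s → i < s → s ≤ n → i < q s → spot st' s ≡ just (owner s)
      ownedHi' s i<s s≤n i<qs with s ≟ suc i | q s ≟ suc i
      ... | yes refl | _ = ⊥-elim (<⇒≱ K<i (subst (i <_) qi≡K i<qs))
      ... | no s≢ | yes qs≡ =
        ⊥-elim (vacant≢occupied vacantI (waitingLo (suc i) s z<s ≤-refl (≢suc⇒suc< i<s s≢) s≤n qs≡))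
      ... | no s≢ | no qs≢ = trans (unchanged s (>⇒≢ (<-trans K<i (≢suc⇒suc< i<s s≢))))
                                   (ownedHi s (≢suc⇒suc< i<s s≢) s≤n (≢suc⇒suc< i<qs qs≢))

      waitingLo' : ∀ s r → 1 ≤ s → s ≤ i → i < r → r ≤ n → q r ≡ s → spot st' s ≡ just (owner r)
      waitingLo' s r 1≤s s≤i i<r r≤n qr≡s with r ≟ suc i | s ≟ suc k
      ... | yes refl | _ = subst (λ x → spot st' x ≡ _) (trans (sym qi≡K) qr≡s) (proj₁ step)
      ... | no r≢ | yes refl =
        ⊥-elim (vacant≢occupied vacantK (waitingLo (suc k) r 1≤s (m≤n⇒m≤1+n s≤i) (≢suc⇒suc< i<r r≢) r≤n qr≡s))
      ... | no r≢ | no s≢K =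
        trans (unchanged s s≢K) (waitingLo s r 1≤s (m≤n⇒m≤1+n s≤i) (≢suc⇒suc< i<r r≢) r≤n qr≡s)

      vacantLo' : ∀ s → 1 ≤ s → s ≤ i → ¬ Claimed q i s → spot st' s ≡ nothing
      vacantLo' s 1≤s s≤i unclaimed =
        trans (unchanged s λ s≡K → unclaimed (suc i , ≤-refl , i<n , trans qi≡K (sym s≡K)))
              (vacantLo s 1≤s (m≤n⇒m≤1+n s≤i) (unclaimed-suc unclaimed))

    arrive-home : q (suc i) ≡ suc i → ¬ Claimed q (suc i) (suc i) →
                  Expected q (arriveAt (owner (suc i)) i st) i
    arrive-home qi≡i nobody = record
      { length≡ = trans (length-arriveAt _ i st) length≡
      ; vacantHi = vacantHi' ; ownedHi = ownedHi' ; waitingLo = waitingLo' ; vacantLo = vacantLo' }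
      where
      st' : Street
      st' = arriveAt (owner (suc i)) i st

      step : spot st' (suc i) ≡ just (owner (suc i)) × Arrival st st' (suc i)
      step = arriving (owner (suc i)) i st i<length

      unchanged : ∀ t → t ≢ suc i → spot st' t ≡ spot st t
      unchanged = arrival-vacant (proj₂ step) (vacantLo (suc i) z<s ≤-refl nobody)

      vacantHi' : ∀ s → i < s → s ≤ n → q s ≤ i → spot st' s ≡ nothing
      vacantHi' s i<s s≤n qs≤i with s ≟ suc i
      ... | yes refl = ⊥-elim (1+n≰n (subst (_≤ i) qi≡i qs≤i))
      ... | no s≢ = trans (unchanged s s≢) (vacantHi s (≢suc⇒suc< i<s s≢) s≤n (m≤n⇒m≤1+n qs≤i))

      ownedHi' : ∀ s → i < s → s ≤ n → i < q s → spot st' s ≡ just (owner s)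
      ownedHi' s i<s s≤n i<qs with s ≟ suc i | q s ≟ suc i
      ... | yes refl | _ = proj₁ step
      ... | no s≢ | yes qs≡ = ⊥-elim (nobody (s , ≢suc⇒suc< i<s s≢ , s≤n , qs≡))
      ... | no s≢ | no qs≢ = trans (unchanged s s≢) (ownedHi s (≢suc⇒suc< i<s s≢) s≤n (≢suc⇒suc< i<qs qs≢))

      waitingLo' : ∀ s r → 1 ≤ s → s ≤ i → i < r → r ≤ n → q r ≡ s → spot st' s ≡ just (owner r)
      waitingLo' s r 1≤s s≤i i<r r≤n qr≡s with r ≟ suc i
      ... | yes refl = ⊥-elim (≤⇒≢suc s≤i (trans (sym qr≡s) qi≡i))
      ... | no r≢ = trans (unchanged s (≤⇒≢suc s≤i))
                          (waitingLo s r 1≤s (m≤n⇒m≤1+n s≤i) (≢suc⇒suc< i<r r≢) r≤n qr≡s)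

      vacantLo' : ∀ s → 1 ≤ s → s ≤ i → ¬ Claimed q i s → spot st' s ≡ nothing
      vacantLo' s 1≤s s≤i unclaimed =
        trans (unchanged s (≤⇒≢suc s≤i)) (vacantLo s 1≤s (m≤n⇒m≤1+n s≤i) (unclaimed-suc unclaimed))

    arrive-bump : q (suc i) ≡ suc i → Nested q (suc i) → Claimed q (suc i) (suc i) →
                  Expected q (arriveAt (owner (suc i)) i st) i
    arrive-bump qi≡i nested (r , i<r , r≤n , qr≡i) = fromArrival (proj₂ step)
      where
      st' : Street
      st' = arriveAt (owner (suc i)) i st

      step : spot st' (suc i) ≡ just (owner (suc i)) × Arrival st st' (suc i)
      step = arriving (owner (suc i)) i st i<length

      waitingI : spot st (suc i) ≡ just (owner r)
      waitingI = waitingLo (suc i) r z<s ≤-refl i<r r≤n qr≡i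

      vacantR : spot st r ≡ nothing
      vacantR = vacantHi r i<r r≤n (≤-reflexive qr≡i)

      -- the arc (i+1, r) is nested, so every spot strictly inside it is held by its owner
      occupiedInside : ∀ t → suc i < t → t < r → spot st t ≢ nothing
      occupiedInside t i<t t<r with q t ≤? suc i
      ... | yes qt≤i = ⊥-elim (nested t r i<t t<r r≤n (≤-<-trans qt≤i i<t)
                                  (≤-trans qt≤i (≤-reflexive (sym qr≡i))) (≤-trans (≤-reflexive qr≡i) (<⇒≤ i<t)))
      ... | no qt≰i = λ v → vacant≢occupied v (ownedHi t i<t (<⇒≤ (<-≤-trans t<r r≤n)) (≰⇒> qt≰i))

      fromArrival : Arrival st st' (suc i) → Expected q st' i
      fromArrival (intoVacant v _) = ⊥-elim (vacant≢occupied v waitingI)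
      fromArrival (bumpsOff _ _ full _) = ⊥-elim (full r i<r (subst (r ≤_) (sym length≡) r≤n) vacantR)
      fromArrival (bumps x f e v fx unchanged) with <-cmp f r
      ... | tri< f<r _ _ = ⊥-elim (occupiedInside f (FirstVacancy.after v) f<r (FirstVacancy.vacant v))
      ... | tri> _ _ r<f = ⊥-elim (FirstVacancy.occupiedBefore v r i<r r<f vacantR)
      ... | tri≈ _ refl _ = record
        { length≡ = trans (length-arriveAt _ i st) length≡
        ; vacantHi = vacantHi' ; ownedHi = ownedHi' ; waitingLo = waitingLo' ; vacantLo = vacantLo' }
        where
        homeR : spot st' r ≡ just (owner r)
        homeR = trans fx (cong just (just-injective (trans (sym e) waitingI)))

        belowR : ∀ {s} → s ≤ i → s ≢ r
        belowR s≤i = <⇒≢ (<-trans (s≤s s≤i) i<r)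

        vacantHi' : ∀ s → i < s → s ≤ n → q s ≤ i → spot st' s ≡ nothing
        vacantHi' s i<s s≤n qs≤i with s ≟ suc i | s ≟ r
        ... | yes refl | _ = ⊥-elim (1+n≰n (subst (_≤ i) qi≡i qs≤i))
        ... | no _ | yes refl = ⊥-elim (1+n≰n (subst (_≤ i) qr≡i qs≤i))
        ... | no s≢ | no s≢r = trans (unchanged s s≢ s≢r) (vacantHi s (≢suc⇒suc< i<s s≢) s≤n (m≤n⇒m≤1+n qs≤i))

        ownedHi' : ∀ s → i < s → s ≤ n → i < q s → spot st' s ≡ just (owner s)
        ownedHi' s i<s s≤n i<qs with s ≟ suc i | s ≟ r | q s ≟ suc i
        ... | yes refl | _ | _ = proj₁ step
        ... | no _ | yes refl | _ = homeR
        ... | no s≢ | no s≢r | yes qs≡ =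
          ⊥-elim (s≢r (Nested⇒leftEnds-distinct nested (≢suc⇒suc< i<s s≢) i<r s≤n r≤n
                         (subst (_< s) (sym qs≡) (≢suc⇒suc< i<s s≢)) (subst (_< r) (sym qr≡i) i<r) (trans qs≡ (sym qr≡i))))
        ... | no s≢ | no s≢r | no qs≢ =
          trans (unchanged s s≢ s≢r) (ownedHi s (≢suc⇒suc< i<s s≢) s≤n (≢suc⇒suc< i<qs qs≢))

        waitingLo' : ∀ s r' → 1 ≤ s → s ≤ i → i < r' → r' ≤ n → q r' ≡ s → spot st' s ≡ just (owner r')
        waitingLo' s r' 1≤s s≤i i<r' r'≤n qr'≡s with r' ≟ suc i
        ... | yes refl = ⊥-elim (≤⇒≢suc s≤i (trans (sym qr'≡s) qi≡i))
        ... | no r'≢ = trans (unchanged s (≤⇒≢suc s≤i) (belowR s≤i))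
                             (waitingLo s r' 1≤s (m≤n⇒m≤1+n s≤i) (≢suc⇒suc< i<r' r'≢) r'≤n qr'≡s)

        vacantLo' : ∀ s → 1 ≤ s → s ≤ i → ¬ Claimed q i s → spot st' s ≡ nothing
        vacantLo' s 1≤s s≤i unclaimed = trans (unchanged s (≤⇒≢suc s≤i) (belowR s≤i))
                                              (vacantLo s 1≤s (m≤n⇒m≤1+n s≤i) (unclaimed-suc unclaimed))

    arrival-Expected : Nested q (suc i) → 1 ≤ q (suc i) → q (suc i) ≤ suc i → Vacant st (q (suc i)) (suc i) →
                       Expected q (arrive (owner (suc i)) (q (suc i)) st) i
    arrival-Expected nested 1≤K K≤i vacant with q (suc i) in qi≡K
    ... | suc k with m≤n⇒m<n∨m≡n K≤i
    ...   | inj₁ K<i = arrive-below qi≡K K<i vacant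
    ...   | inj₂ refl with claimed? q (suc i) (suc i)
    ...     | no nobody = arrive-home qi≡K nobody
    ...     | yes claim = arrive-bump qi≡K nested claim

  -- What the street must satisfy once the owners of spots i+1..n have arrived, for the
  -- remaining arrivals to end in dec_n.
  record Consistent (st : Street) (i : ℕ) : Set where
    field
      length≡    : length st ≡ n
      right      : ∀ s → i < s → s ≤ n → spot st s ≡ nothing ⊎ spot st s ≡ just (owner s)
      left       : ∀ s → 1 ≤ s → s ≤ i →
                   spot st s ≡ nothing ⊎ ∃[ r ] (i < r × r ≤ n × spot st s ≡ just (owner r) × spot st r ≡ nothing)
      increasing : ∀ s s' x y → s < s' → s' ≤ i → spot st s ≡ just x → spot st s' ≡ just y → x < y

  module _ {st : Street} {i k : ℕ} (i<n : suc i ≤ n) (K≤n : suc k ≤ n) (length≡ : length st ≡ n)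
           (C : Consistent (arriveAt (owner (suc i)) k st) i) where
    open Consistent C using () renaming (right to right'; left to left'; increasing to increasing')

    private
      st' : Street
      st' = arriveAt (owner (suc i)) k st

      step : spot st' (suc k) ≡ just (owner (suc i)) × Arrival st st' (suc k)
      step = arriving (owner (suc i)) k st (subst (suc k ≤_) (sym length≡) K≤n)

      parked : spot st' (suc k) ≡ just (owner (suc i))
      parked = proj₁ step

    arrival-spot : suc k ≡ suc i ⊎ (suc k ≤ i × spot st' (suc i) ≡ nothing)
    arrival-spot with i <? suc k
    ... | yes i<K with right' (suc k) i<K K≤n
    ...   | inj₁ v = ⊥-elim (vacant≢occupied v parked)
    ...   | inj₂ o = inj₁ (owner-injective K≤n i<n (just-injective (trans (sym o) parked)))
    arrival-spot | no i≮K with left' (suc k) z<s (≮⇒≥ i≮K)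
    ...   | inj₁ v = ⊥-elim (vacant≢occupied v parked)
    ...   | inj₂ (r , i<r , r≤n , o , vr) with owner-injective r≤n i<n (just-injective (trans (sym o) parked))
    ...     | refl = inj₂ (≮⇒≥ i≮K , vr)

    arrival-spot-≤ : suc k ≤ suc i
    arrival-spot-≤ with arrival-spot
    ... | inj₁ K≡i = ≤-reflexive K≡i
    ... | inj₂ (K≤i , _) = m≤n⇒m≤1+n K≤i

    private
      vacantI : suc k < suc i → spot st' (suc i) ≡ nothing
      vacantI K<i with arrival-spot
      ... | inj₁ K≡i = ⊥-elim (<-irrefl K≡i K<i)
      ... | inj₂ (_ , v) = v

      -- the newcomer owner (i+1) is the largest car so far, and cars increase along spots 1..i
      newcomer-largest : ∀ {s r} → suc k < s → s ≤ i → spot st' s ≡ just (owner r) → i < r → ⊥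
      newcomer-largest K<s s≤i o i<r = <⇒≱ (owner-reflects-< (increasing' (suc k) _ _ _ K<s s≤i parked o)) i<r

    reverse-intoVacant : spot st (suc k) ≡ nothing → (∀ t → t ≢ suc k → spot st' t ≡ spot st t) →
                         Consistent st (suc i) × Vacant st (suc k) (suc i)
    reverse-intoVacant vacantK unchanged =
      record { length≡ = length≡ ; right = right ; left = left ; increasing = increasing } , vacant
      where
      back : ∀ {s v} → s ≢ suc k → spot st' s ≡ v → spot st s ≡ v
      back s≢K e = trans (sym (unchanged _ s≢K)) e

      notK : ∀ {s} → suc i < s → s ≢ suc k
      notK i<s s≡K = <⇒≱ i<s (subst (_≤ suc i) (sym s≡K) arrival-spot-≤)

      vacant : Vacant st (suc k) (suc i)
      vacant K<i s K≤s s≤i with s ≟ suc k | s ≟ suc i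
      ... | yes refl | _ = vacantK
      ... | no s≢K | yes refl = back s≢K (vacantI K<i)
      ... | no s≢K | no s≢ with left' s (≤-trans (s≤s z≤n) K≤s) (≢suc⇒≤ s≤i s≢)
      ...   | inj₁ v = back s≢K v
      ...   | inj₂ (r , i<r , _ , o , _) =
        ⊥-elim (newcomer-largest (≤∧≢⇒< K≤s (≢-sym s≢K)) (≢suc⇒≤ s≤i s≢) o i<r)

      right : ∀ s → suc i < s → s ≤ n → spot st s ≡ nothing ⊎ spot st s ≡ just (owner s)
      right s i<s s≤n with right' s (<⇒≤ i<s) s≤n
      ... | inj₁ v = inj₁ (back (notK i<s) v)
      ... | inj₂ o = inj₂ (back (notK i<s) o)

      left : ∀ s → 1 ≤ s → s ≤ suc i →
             spot st s ≡ nothing ⊎ ∃[ r ] (suc i < r × r ≤ n × spot st s ≡ just (owner r) × spot st r ≡ nothing)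
      left s 1≤s s≤i with s ≟ suc k | s ≟ suc i
      ... | yes refl | _ = inj₁ vacantK
      ... | no s≢K | yes refl = inj₁ (back s≢K (vacantI (≤∧≢⇒< arrival-spot-≤ (≢-sym s≢K))))
      ... | no s≢K | no s≢ with left' s 1≤s (≢suc⇒≤ s≤i s≢)
      ...   | inj₁ v = inj₁ (back s≢K v)
      ...   | inj₂ (r , i<r , r≤n , o , vr) with r ≟ suc i
      ...     | no r≢ = inj₂ (r , ≢suc⇒suc< i<r r≢ , r≤n , back s≢K o , back (notK (≢suc⇒suc< i<r r≢)) vr)
      ...     | yes refl with arrival-spot
      ...       | inj₁ K≡i = ⊥-elim (vacant≢occupied vr (subst (λ x → spot st' x ≡ just (owner (suc i))) K≡i parked))
      ...       | inj₂ (K≤i , _) with <-cmp s (suc k)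
      ...         | tri< s<K _ _ = ⊥-elim (<-irrefl refl (increasing' s (suc k) _ _ s<K K≤i o parked))
      ...         | tri≈ _ s≡K _ = ⊥-elim (s≢K s≡K)
      ...         | tri> _ _ K<s = ⊥-elim (<-irrefl refl (increasing' (suc k) s _ _ K<s (≢suc⇒≤ s≤i s≢) parked o))

      increasing : ∀ s s' x y → s < s' → s' ≤ suc i → spot st s ≡ just x → spot st s' ≡ just y → x < y
      increasing s s' x y s<s' s'≤i ox oy with s ≟ suc k | s' ≟ suc k | s' ≟ suc i
      ... | yes refl | _ | _ = ⊥-elim (vacant≢occupied vacantK ox)
      ... | no _ | yes refl | _ = ⊥-elim (vacant≢occupied vacantK oy)
      ... | no _ | no s'≢K | yes refl =
        ⊥-elim (vacant≢occupied (back s'≢K (vacantI (≤∧≢⇒< arrival-spot-≤ (≢-sym s'≢K)))) oy)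
      ... | no s≢K | no s'≢K | no s'≢ =
        increasing' s s' x y s<s' (≢suc⇒≤ s'≤i s'≢) (trans (unchanged s s≢K) ox) (trans (unchanged s' s'≢K) oy)

    bump-home : ∀ {x f} → FirstVacancy st (suc k) f → spot st' f ≡ just x →
                (∀ t → t ≢ suc k → t ≢ f → spot st' t ≡ spot st t) → suc k ≡ suc i
    bump-home {x} {f} v fx unchanged with arrival-spot
    ... | inj₁ K≡i = K≡i
    ... | inj₂ (K≤i , vacantI') with <-cmp f (suc i)
    ...   | tri≈ _ refl _ = ⊥-elim (vacant≢occupied vacantI' fx)
    ...   | tri> _ _ i<f = ⊥-elim (FirstVacancy.occupiedBefore v (suc i) (s≤s K≤i) i<f
                              (trans (sym (unchanged (suc i) (>⇒≢ (s≤s K≤i)) (<⇒≢ i<f))) vacantI'))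
    ...   | tri< f<i _ _ with left' f (≤-trans z<s (<⇒≤ (FirstVacancy.after v))) (s≤s⁻¹ f<i)
    ...     | inj₁ v' = ⊥-elim (vacant≢occupied v' fx)
    ...     | inj₂ (r , i<r , _ , o , _) = ⊥-elim (newcomer-largest (FirstVacancy.after v) (s≤s⁻¹ f<i) o i<r)

    reverse-bumps : ∀ x f → spot st (suc k) ≡ just x → FirstVacancy st (suc k) f → spot st' f ≡ just x →
                    (∀ t → t ≢ suc k → t ≢ f → spot st' t ≡ spot st t) → Consistent st (suc i)
    reverse-bumps x f e v fx unchanged =
      record { length≡ = length≡ ; right = right ; left = left ; increasing = increasing }
      where
      open FirstVacancy v
      K≡i : suc k ≡ suc i
      K≡i = bump-home v fx unchanged

      i<f : suc i < f
      i<f = subst (_< f) K≡i after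

      f≤n : f ≤ n
      f≤n = subst (f ≤_) length≡ inStreet

      bumpedI : spot st (suc i) ≡ just (owner f)
      bumpedI with right' f (<⇒≤ i<f) f≤n
      ... | inj₁ v' = ⊥-elim (vacant≢occupied v' fx)
      ... | inj₂ o = subst₂ (λ s y → spot st s ≡ just y) K≡i (just-injective (trans (sym fx) o)) e

      parkedI : spot st' (suc i) ≡ just (owner (suc i))
      parkedI = subst (λ s → spot st' s ≡ just (owner (suc i))) K≡i parked

      unchangedI : ∀ t → t ≢ suc i → t ≢ f → spot st' t ≡ spot st t
      unchangedI t t≢ t≢f = unchanged t (λ t≡K → t≢ (trans t≡K K≡i)) t≢f

      back : ∀ {s y} → s ≢ suc i → s ≢ f → spot st' s ≡ y → spot st s ≡ y
      back s≢ s≢f e' = trans (sym (unchangedI _ s≢ s≢f)) e'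

      notF : ∀ {s} → s ≤ i → s ≢ f
      notF s≤i = <⇒≢ (<-trans (s≤s s≤i) i<f)

      right : ∀ s → suc i < s → s ≤ n → spot st s ≡ nothing ⊎ spot st s ≡ just (owner s)
      right s i<s s≤n with s ≟ f | right' s (<⇒≤ i<s) s≤n
      ... | yes refl | _ = inj₁ vacant
      ... | no s≢f | inj₁ v' = inj₁ (back (>⇒≢ i<s) s≢f v')
      ... | no s≢f | inj₂ o = inj₂ (back (>⇒≢ i<s) s≢f o)

      left : ∀ s → 1 ≤ s → s ≤ suc i →
             spot st s ≡ nothing ⊎ ∃[ r ] (suc i < r × r ≤ n × spot st s ≡ just (owner r) × spot st r ≡ nothing)
      left s 1≤s s≤i with s ≟ suc i
      ... | yes refl = inj₂ (f , i<f , f≤n , bumpedI , vacant)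
      ... | no s≢ with left' s 1≤s (≢suc⇒≤ s≤i s≢)
      ...   | inj₁ v' = inj₁ (back s≢ (notF (≢suc⇒≤ s≤i s≢)) v')
      ...   | inj₂ (r , i<r , r≤n , o , vr) with r ≟ suc i | r ≟ f
      ...     | yes refl | _ = ⊥-elim (vacant≢occupied vr parkedI)
      ...     | no _ | yes refl = ⊥-elim (vacant≢occupied vr fx)
      ...     | no r≢ | no r≢f =
        inj₂ (r , ≢suc⇒suc< i<r r≢ , r≤n , back s≢ (notF (≢suc⇒≤ s≤i s≢)) o , back r≢ r≢f vr)

      increasing : ∀ s s' x y → s < s' → s' ≤ suc i → spot st s ≡ just x → spot st s' ≡ just y → x < y
      increasing zero s' x y _ _ () _
      increasing s@(suc _) s' x y s<s' s'≤i ox oy with s' ≟ suc i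
      ... | no s'≢ = increasing' s s' x y s<s' s'≤i' (trans (unchangedI s (≤⇒≢suc s≤i') (notF s≤i')) ox)
                                                   (trans (unchangedI s' s'≢ (notF s'≤i')) oy)
        where
        s'≤i' : s' ≤ i
        s'≤i' = ≢suc⇒≤ s'≤i s'≢

        s≤i' : s ≤ i
        s≤i' = <⇒≤ (<-≤-trans s<s' s'≤i')
      ... | yes refl with left' s (s≤s z≤n) (s≤s⁻¹ s<s')
      ...   | inj₁ v' = ⊥-elim (vacant≢occupied (back (<⇒≢ s<s') (notF (s≤s⁻¹ s<s')) v') ox)
      ...   | inj₂ (r , i<r , r≤n , o , vr) with r ≟ suc i | r ≟ f | <-cmp r f
      ...     | yes refl | _ | _ = ⊥-elim (vacant≢occupied vr parkedI)
      ...     | no _ | yes refl | _ = ⊥-elim (vacant≢occupied vr fx)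
      ...     | no r≢ | no r≢f | tri< r<f _ _ =
        ⊥-elim (occupiedBefore r (subst (_< r) (sym K≡i) (≢suc⇒suc< i<r r≢)) r<f (back r≢ r≢f vr))
      ...     | no _ | no r≢f | tri≈ _ r≡f _ = ⊥-elim (r≢f r≡f)
      ...     | no _ | no _ | tri> _ _ f<r =
        subst₂ _<_ (just-injective (trans (sym (back (<⇒≢ s<s') (notF (s≤s⁻¹ s<s')) o)) ox))
                   (just-injective (trans (sym bumpedI) oy)) (owner-decreasing f<r r≤n)

    -- a car driving off would need spots i+1..n all full: more cars than have arrived
    bumpsOff-impossible : occupancy st ≤ n ∸ suc i → ∀ x → spot st (suc k) ≡ just x → FullAfter st (suc k) →
                          (∀ t → t ≢ suc k → spot st' t ≡ spot st t) → ⊥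
    bumpsOff-impossible few x e full unchanged with arrival-spot
    ... | inj₂ (K≤i , vacantI') =
      full (suc i) (s≤s K≤i) (subst (suc i ≤_) (sym length≡) i<n)
           (trans (sym (unchanged (suc i) (>⇒≢ (s≤s K≤i)))) vacantI')
    ... | inj₁ K≡i = 1+n≰n (≤-trans many few)
      where
      fullFromI : FullAfter st i
      fullFromI t i<t t≤ with t ≟ suc i
      ... | yes refl = λ v → vacant≢occupied v (subst (λ s → spot st s ≡ just x) K≡i e)
      ... | no t≢ = full t (subst (_< t) (sym K≡i) (≢suc⇒suc< i<t t≢)) t≤

      many : suc (n ∸ suc i) ≤ occupancy st
      many = subst (_≤ occupancy st) (trans (cong (_∸ i) length≡) (+-∸-assoc 1 i<n)) (occupancy-full st i fullFromI)

    reverse-arrival : occupancy st ≤ n ∸ suc i → Consistent st (suc i) × Vacant st (suc k) (suc i)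
    reverse-arrival few with proj₂ step
    ... | intoVacant v unchanged = reverse-intoVacant v unchanged
    ... | bumps x f e v fx unchanged =
      reverse-bumps x f e v fx unchanged , λ K<i → ⊥-elim (<-irrefl (bump-home v fx unchanged) K<i)
    ... | bumpsOff x e full unchanged = ⊥-elim (bumpsOff-impossible few x e full unchanged)

  reverse-arrive : ∀ {st i x} → suc i ≤ n → 1 ≤ x → x ≤ n → length st ≡ n → occupancy st ≤ n ∸ suc i →
                   Consistent (arrive (owner (suc i)) x st) i →
                   Consistent st (suc i) × x ≤ suc i × Vacant st x (suc i)
  reverse-arrive {st} {i} {suc k} i<n _ K≤n length≡ few C =
    proj₁ reversed , arrival-spot-≤ i<n K≤n length≡ C , proj₂ reversed
    where
    reversed : Consistent st (suc i) × Vacant st (suc k) (suc i)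
    reversed = reverse-arrival i<n K≤n length≡ C few

  InRange : ℕ → Set
  InRange x = 1 ≤ x × x ≤ n

  occupancy-step : ∀ {st i} c x → i < n → occupancy st ≤ n ∸ suc i → occupancy (arrive c x st) ≤ n ∸ i
  occupancy-step {st} c x i<n few =
    ≤-trans (occupancy-arrive c x st) (subst (suc (occupancy st) ≤_) (sym (+-∸-assoc 1 i<n)) (s≤s few))

  runFrom-Consistent⁻ : ∀ i xs st → i ≤ n → length xs ≡ i → All InRange xs → length st ≡ n →
                        occupancy st ≤ n ∸ i → Consistent (runFrom (owner i) xs st) 0 → Consistent st i
  runFrom-Consistent⁻ zero    []       st _   _   _          _       _   C = C
  runFrom-Consistent⁻ (suc i) (x ∷ xs) st i<n len (px ∷ pxs) length≡ few C =
    proj₁ (reverse-arrive i<n (proj₁ px) (proj₂ px) length≡ few C')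
    where
    st' : Street
    st' = arrive (owner (suc i)) x st

    C' : Consistent st' i
    C' = runFrom-Consistent⁻ i xs st' (<⇒≤ i<n) (suc-injective len) pxs
           (trans (length-arrive _ x st) length≡) (occupancy-step _ x i<n few)
           (subst (λ c → Consistent (runFrom c xs st') 0) (owner-suc i<n) C)

  Expected-initial : ∀ q → Expected q (replicate n nothing) n
  Expected-initial q = record
    { length≡   = length-replicate n
    ; vacantHi  = λ s n<s s≤n _ → ⊥-elim (<⇒≱ n<s s≤n)
    ; ownedHi   = λ s n<s s≤n _ → ⊥-elim (<⇒≱ n<s s≤n)
    ; waitingLo = λ s r _ _ n<r r≤n _ → ⊥-elim (<⇒≱ n<r r≤n)
    ; vacantLo  = λ s _ _ _ → spot-replicate n s }

  length-decStreet : length (map just (dec n)) ≡ n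
  length-decStreet = trans (length-map just (dec n)) (length-dec n)

  Expected⇒dec : ∀ {q st} → Expected q st 0 → Bounded q 0 → st ≡ map just (dec n)
  Expected⇒dec {q} {st} E bounded = spot-ext st _ (trans length≡ (sym length-decStreet)) same
    where
    open Expected E
    same : ∀ s → spot st s ≡ spot (map just (dec n)) s
    same zero = refl
    same (suc s) with suc s ≤? n
    ... | yes s≤n = trans (ownedHi (suc s) z<s s≤n (proj₁ (bounded (suc s) z<s s≤n))) (sym (spot-dec n (suc s) z<s s≤n))
    ... | no s≰n = trans (spot-beyond st (suc s) (subst (_< suc s) (sym length≡) (≰⇒> s≰n)))
                         (sym (spot-beyond (map just (dec n)) (suc s) (subst (_< suc s) (sym length-decStreet) (≰⇒> s≰n))))

  Consistent-dec : Consistent (map just (dec n)) 0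
  Consistent-dec = record
    { length≡    = length-decStreet
    ; right      = λ s 0<s s≤n → inj₂ (spot-dec n s 0<s s≤n)
    ; left       = λ s 1≤s s≤0 → ⊥-elim (<⇒≱ 1≤s s≤0)
    ; increasing = λ s s' _ _ s<s' s'≤0 _ _ → ⊥-elim (<⇒≱ (≤-<-trans z≤n s<s') s'≤0) }

  -- the preference p_{n+1-t} of owner t
  pref : Vec ℕ n → ℕ → ℕ
  pref p t = fromMaybe 0 (nth (n ∸ t) (toList p))

  module Run (p : Vec ℕ n) where

    q : ℕ → ℕ
    q = pref p

    -- the preferences of the cars still to come once the owners of spots i+1..n have arrived
    remaining : ℕ → List ℕ
    remaining i = drop (n ∸ i) (toList p)

    length-prefs : length (toList p) ≡ n
    length-prefs = length-toList p

    remaining-suc : ∀ {i} → i < n → remaining (suc i) ≡ q (suc i) ∷ remaining i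
    remaining-suc {i} i<n =
      trans (drop-∷ 0 (n ∸ suc i) (toList p) (subst (n ∸ suc i <_) (sym length-prefs) (∸-monoʳ-< z<s i<n)))
            (cong (λ m → q (suc i) ∷ drop m (toList p)) (sym (+-∸-assoc 1 i<n)))

    remaining-zero : remaining 0 ≡ []
    remaining-zero = drop-all n (toList p) (≤-reflexive length-prefs)

    remaining-all : remaining n ≡ toList p
    remaining-all = cong (λ m → drop m (toList p)) (n∸n≡0 n)

    length-remaining : ∀ {i} → i ≤ n → length (remaining i) ≡ i
    length-remaining {i} i≤n = trans (length-drop (n ∸ i) (toList p))
                                     (trans (cong (_∸ (n ∸ i)) length-prefs) (m∸[m∸n]≡n i≤n))

    runFrom-step : ∀ {i} st → i < n →
                   runFrom (owner (suc i)) (remaining (suc i)) st ≡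
                   runFrom (owner i) (remaining i) (arrive (owner (suc i)) (q (suc i)) st)
    runFrom-step {i} st i<n = begin
      runFrom (owner (suc i)) (remaining (suc i)) st
        ≡⟨ cong (λ xs → runFrom (owner (suc i)) xs st) (remaining-suc i<n) ⟩
      runFrom (suc (owner (suc i))) (remaining i) (arrive (owner (suc i)) (q (suc i)) st)
        ≡⟨ cong (λ c → runFrom c (remaining i) (arrive (owner (suc i)) (q (suc i)) st)) (owner-suc i<n) ⟩
      runFrom (owner i) (remaining i) (arrive (owner (suc i)) (q (suc i)) st) ∎
      where open ≡-Reasoning

    runFrom-all : finalStreet n p ≡ runFrom (owner n) (remaining n) (replicate n nothing)
    runFrom-all = cong₂ (λ c xs → runFrom c xs (replicate n nothing)) (sym (cong suc (n∸n≡0 n))) (sym remaining-all)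

    runFrom-Expected : Nested q 0 → Bounded q 0 → ∀ i st → i ≤ n → Expected q st i →
                       Expected q (runFrom (owner i) (remaining i) st) 0
    runFrom-Expected nested bounded zero st _ E =
      subst (λ xs → Expected q (runFrom (owner 0) xs st) 0) (sym remaining-zero) E
    runFrom-Expected nested bounded (suc i) st i<n E =
      subst (λ st' → Expected q st' 0) (sym (runFrom-step st i<n))
        (runFrom-Expected nested bounded i _ (<⇒≤ i<n)
          (arrival-Expected i<n E (Nested-weaken z≤n nested) 1≤K K≤i
            (Nested⇒Vacant i<n E (Nested-weaken z≤n nested) 1≤K)))
      where
      1≤K : 1 ≤ q (suc i)
      1≤K = proj₁ (bounded (suc i) z<s i<n)

      K≤i : q (suc i) ≤ suc i
      K≤i = proj₂ (bounded (suc i) z<s i<n)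

    Nested∧Bounded⇒dec : Nested q 0 → Bounded q 0 → finalStreet n p ≡ map just (dec n)
    Nested∧Bounded⇒dec nested bounded =
      Expected⇒dec (subst (λ st → Expected q st 0) (sym runFrom-all)
                      (runFrom-Expected nested bounded n _ ≤-refl (Expected-initial q))) bounded

    -- Expected tracks the run forwards, while Consistent, propagated back from dec_n,
    -- supplies at each stage the condition that the next arrival needs.
    runFrom-conditions : ∀ i st → i ≤ n → All InRange (remaining i) → Expected q st i → Nested q i → Bounded q i →
                         occupancy st ≤ n ∸ i → Consistent (runFrom (owner i) (remaining i) st) 0 →
                         Nested q 0 × Bounded q 0
    runFrom-conditions zero    st _   _      _ nested bounded _   _ = nested , bounded
    runFrom-conditions (suc i) st i<n ranges E nested bounded few C with subst (All InRange) (remaining-suc i<n) ranges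
    ... | K∈range ∷ ranges' =
      runFrom-conditions i st' (<⇒≤ i<n) ranges' (arrival-Expected i<n E nested (proj₁ K∈range) K≤i vacant)
        (Vacant⇒Nested E nested (proj₁ K∈range) vacant) bounded' few' C'
      where
      st' : Street
      st' = arrive (owner (suc i)) (q (suc i)) st

      few' : occupancy st' ≤ n ∸ i
      few' = occupancy-step {st} (owner (suc i)) (q (suc i)) i<n few

      C' : Consistent (runFrom (owner i) (remaining i) st') 0
      C' = subst (λ s → Consistent s 0) (runFrom-step st i<n) C

      reversed : Consistent st (suc i) × q (suc i) ≤ suc i × Vacant st (q (suc i)) (suc i)
      reversed = reverse-arrive i<n (proj₁ K∈range) (proj₂ K∈range) (Expected.length≡ E) few
                   (runFrom-Consistent⁻ i (remaining i) st' (<⇒≤ i<n) (length-remaining (<⇒≤ i<n)) ranges'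
                      (trans (length-arrive _ (q (suc i)) st) (Expected.length≡ E)) few' C')

      K≤i : q (suc i) ≤ suc i
      K≤i = proj₁ (proj₂ reversed)

      vacant : Vacant st (q (suc i)) (suc i)
      vacant = proj₂ (proj₂ reversed)

      bounded' : Bounded q i
      bounded' r i<r r≤n with r ≟ suc i
      ... | yes refl = proj₁ K∈range , K≤i
      ... | no r≢ = bounded r (≤∧≢⇒< i<r (≢-sym r≢)) r≤n

    dec⇒Nested∧Bounded : All InRange (toList p) → finalStreet n p ≡ map just (dec n) → Nested q 0 × Bounded q 0
    dec⇒Nested∧Bounded ranges final≡dec =
      runFrom-conditions n (replicate n nothing) ≤-refl (subst (All InRange) (sym remaining-all) ranges)
        (Expected-initial q) (λ t r n<t t<r r≤n → ⊥-elim (<⇒≱ (<-trans n<t t<r) r≤n))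
        (λ r n<r r≤n → ⊥-elim (<⇒≱ n<r r≤n))
        (≤-reflexive (trans (occupancy-replicate n) (sym (n∸n≡0 n))))
        (subst (λ st → Consistent st 0) (trans (sym final≡dec) runFrom-all) Consistent-dec)

module Matchings (n : ℕ) where
  open Parking n
    using (Bounded; Nested; Nested⇒leftEnds-distinct; Agree; Bounded-cong; Nested-cong; InRange; pref; module Run)

  arc-nth : ∀ (Δ : ArcDiagram n) {j i row} → nth j (toList Δ) ≡ just row →
            arc Δ (suc j) (suc i) ≡ fromMaybe false (nth i (toList row))
  arc-nth Δ e rewrite e = refl

  arc-range : ∀ (Δ : ArcDiagram n) j i → arc Δ j i ≡ true → 1 ≤ j × j ≤ n × 1 ≤ i × i ≤ n
  arc-range Δ (suc j) (suc i) a with nth j (toList Δ) in row∈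
  ... | just row with nth i (toList row) in b∈
  ...   | just true = s≤s z≤n , subst (j <_) (length-toList Δ) (nth-bound (toList Δ) j row∈) ,
                      s≤s z≤n , subst (i <_) (length-toList row) (nth-bound (toList row) i b∈)

  firstArcTo-just : ∀ (Δ : ArcDiagram n) i js {j} → firstArcTo Δ i js ≡ just j → arc Δ j i ≡ true
  firstArcTo-just Δ i (j' ∷ js) e with arc Δ j' i in a
  ... | true  = subst (λ j → arc Δ j i ≡ true) (just-injective e) a
  ... | false = firstArcTo-just Δ i js e

  firstArcTo-nothing : ∀ (Δ : ArcDiagram n) i js {j} → firstArcTo Δ i js ≡ nothing → j ∈ js → arc Δ j i ≢ true
  firstArcTo-nothing Δ i (j' ∷ js) e j∈ a with arc Δ j' i in a'
  firstArcTo-nothing Δ i (j' ∷ js) () j∈ a | true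
  firstArcTo-nothing Δ i (j' ∷ js) e (here refl) a | false = case trans (sym a') a of λ ()
  firstArcTo-nothing Δ i (j' ∷ js) e (there j∈) a | false = firstArcTo-nothing Δ i js e j∈ a

  partner-cases : ∀ (Δ : ArcDiagram n) i → partner Δ i ≡ i ⊎ arc Δ (partner Δ i) i ≡ true
  partner-cases Δ i with firstArcTo Δ i (map suc (upTo n)) in e
  ... | just j  = inj₂ (firstArcTo-just Δ i (map suc (upTo n)) e)
  ... | nothing = inj₁ refl

  partner-arc : ∀ (Δ : ArcDiagram n) {j i} → arc Δ j i ≡ true → arc Δ (partner Δ i) i ≡ true
  partner-arc Δ {j} {i} a with firstArcTo Δ i (map suc (upTo n)) in e | arc-range Δ j i a
  ... | just _  | _ = firstArcTo-just Δ i (map suc (upTo n)) e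
  ... | nothing | 1≤j , j≤n , _ =
    ⊥-elim (firstArcTo-nothing Δ i (map suc (upTo n)) e (∈-suc-upTo 1≤j j≤n) a)
    where
    ∈-suc-upTo : ∀ {j} → 1 ≤ j → j ≤ n → j ∈ map suc (upTo n)
    ∈-suc-upTo {suc j} _ j<n = ∈-map⁺ suc (∈-upTo⁺ j<n)

  module _ {Δ : ArcDiagram n} (matching : IsNonCrossingMatching Δ) where
    private
      increasing : IsArcDiagram Δ
      increasing = proj₁ matching

      disjoint : ∀ j i j' i' v → arc Δ j i ≡ true → arc Δ j' i' ≡ true →
                 (v ≡ j ⊎ v ≡ i) → (v ≡ j' ⊎ v ≡ i') → j ≡ j' × i ≡ i'
      disjoint = proj₁ (proj₂ matching)

      crossless : ∀ a b c d → a < b → b < c → c < d → arc Δ a c ≡ true → arc Δ b d ≡ true → ⊥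
      crossless = proj₂ (proj₂ matching)

    arc-injectiveˡ : ∀ {j j' i} → arc Δ j i ≡ true → arc Δ j' i ≡ true → j ≡ j'
    arc-injectiveˡ {j} {j'} {i} a a' = proj₁ (disjoint j i j' i i a a' (inj₂ refl) (inj₂ refl))

    partner-matching : ∀ {j i} → arc Δ j i ≡ true → partner Δ i ≡ j
    partner-matching {j} {i} a = arc-injectiveˡ {partner Δ i} {j} (partner-arc Δ {j} a) a

    partner-Bounded : Bounded (partner Δ) 0
    partner-Bounded r 0<r r≤n with partner-cases Δ r
    ... | inj₁ e = subst (1 ≤_) (sym e) 0<r , ≤-reflexive e
    ... | inj₂ a = proj₁ (arc-range Δ (partner Δ r) r a) , <⇒≤ (increasing (partner Δ r) r a)

    partner-Nested : Nested (partner Δ) 0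
    partner-Nested t r _ t<r _ qt<t qt≤qr qr≤t with partner-cases Δ t | partner-cases Δ r
    ... | inj₁ e | _ = <-irrefl e qt<t
    ... | _ | inj₁ e = <-irrefl e (≤-<-trans qr≤t t<r)
    ... | inj₂ at | inj₂ ar with m≤n⇒m<n∨m≡n qt≤qr | m≤n⇒m<n∨m≡n qr≤t
    ...   | inj₂ e | _ =
      <-irrefl (proj₂ (disjoint (partner Δ t) t (partner Δ r) r (partner Δ t) at ar (inj₁ refl) (inj₁ e))) t<r
    ...   | _ | inj₂ e = <-irrefl (proj₂ (disjoint (partner Δ t) t (partner Δ r) r t at ar (inj₂ refl) (inj₁ (sym e)))) t<r
    ...   | inj₁ qt<qr | inj₁ qr<t = crossless (partner Δ t) (partner Δ r) t r qt<qr qr<t t<r at ar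

  Encodes : ArcDiagram n → (ℕ → ℕ) → Set
  Encodes Δ q = ∀ j i → 1 ≤ i → i ≤ n → arc Δ j i ≡ true ⇔ (q i ≡ j × j < i)

  Encodes-cong : ∀ {Δ q q'} → Agree q q' → Encodes Δ q → Encodes Δ q'
  Encodes-cong agree encodes j i 1≤i i≤n rewrite sym (agree i 1≤i i≤n) = encodes j i 1≤i i≤n

  matching-Encodes : ∀ {Δ} → IsNonCrossingMatching Δ → Encodes Δ (partner Δ)
  matching-Encodes {Δ} matching j i _ _ = mk⇔
    (λ a → partner-matching matching a , proj₁ matching j i a)
    (λ (e , j<i) → case partner-cases Δ i of λ
      { (inj₁ p≡i) → ⊥-elim (<-irrefl (trans (sym e) p≡i) j<i)
      ; (inj₂ a)   → subst (λ j → arc Δ j i ≡ true) e a })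

  arc-lookup : ∀ (Δ : ArcDiagram n) a b → arc Δ (suc (toℕ a)) (suc (toℕ b)) ≡ lookup (lookup Δ a) b
  arc-lookup Δ a b = trans (arc-nth Δ (nth-lookup Δ a)) (cong (fromMaybe false) (nth-lookup (lookup Δ a) b))

  Encodes-unique : ∀ {Δ Δ' q} → Encodes Δ q → Encodes Δ' q → Δ ≡ Δ'
  Encodes-unique {Δ} {Δ'} encodes encodes' = lookup-ext λ a → lookup-ext λ b → begin
    lookup (lookup Δ a) b                ≡⟨ arc-lookup Δ a b ⟨
    arc Δ (suc (toℕ a)) (suc (toℕ b))
      ≡⟨ ⇔→≡ (⇔-trans (encodes _ _ z<s (toℕ<n b)) (⇔-sym (encodes' _ _ z<s (toℕ<n b)))) ⟩
    arc Δ' (suc (toℕ a)) (suc (toℕ b))   ≡⟨ arc-lookup Δ' a b ⟩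
    lookup (lookup Δ' a) b               ∎
    where open ≡-Reasoning

  Encodes⇒matching : ∀ {Δ q} → Encodes Δ q → Nested q 0 → IsNonCrossingMatching Δ
  Encodes⇒matching {Δ} {q} encodes nested = increasing , disjoint , crossless
    where
    arc⇒ : ∀ j i → arc Δ j i ≡ true → q i ≡ j × j < i
    arc⇒ j i a with arc-range Δ j i a
    ... | _ , _ , 1≤i , i≤n = Equivalence.to (encodes j i 1≤i i≤n) a

    i≤n : ∀ j i → arc Δ j i ≡ true → i ≤ n
    i≤n j i a = proj₂ (proj₂ (proj₂ (arc-range Δ j i a)))

    increasing : IsArcDiagram Δ
    increasing j i a = proj₂ (arc⇒ j i a)

    shared-left : ∀ j i i' → arc Δ j i ≡ true → arc Δ j i' ≡ true → i ≡ i'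
    shared-left j i i' a a' with arc⇒ j i a | arc⇒ j i' a'
    ... | e , j<i | e' , j<i' =
      Nested⇒leftEnds-distinct nested (≤-<-trans z≤n j<i) (≤-<-trans z≤n j<i') (i≤n j i a) (i≤n j i' a')
        (subst (_< i) (sym e) j<i) (subst (_< i') (sym e') j<i') (trans e (sym e'))

    right-left : ∀ j i i' → arc Δ j i ≡ true → arc Δ i i' ≡ true → ⊥
    right-left j i i' a a' with arc⇒ j i a | arc⇒ i i' a'
    ... | e , j<i | e' , i<i' =
      nested i i' (≤-<-trans z≤n j<i) i<i' (i≤n i i' a') (subst (_< i) (sym e) j<i)
        (≤-trans (≤-reflexive e) (≤-trans (<⇒≤ j<i) (≤-reflexive (sym e')))) (≤-reflexive e')

    disjoint : ∀ j i j' i' v → arc Δ j i ≡ true → arc Δ j' i' ≡ true →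
               (v ≡ j ⊎ v ≡ i) → (v ≡ j' ⊎ v ≡ i') → j ≡ j' × i ≡ i'
    disjoint j i j' i' v a a' (inj₁ refl) (inj₁ refl) = refl , shared-left j i i' a a'
    disjoint j i j' i' v a a' (inj₂ refl) (inj₂ refl) = trans (sym (proj₁ (arc⇒ j i a))) (proj₁ (arc⇒ j' i a')) , refl
    disjoint j i j' i' v a a' (inj₁ refl) (inj₂ refl) = ⊥-elim (right-left j' j i a' a)
    disjoint j i j' i' v a a' (inj₂ refl) (inj₁ refl) = ⊥-elim (right-left j i i' a a')

    crossless : ∀ a b c d → a < b → b < c → c < d → arc Δ a c ≡ true → arc Δ b d ≡ true → ⊥
    crossless a b c d a<b b<c c<d ac bd with arc⇒ a c ac | arc⇒ b d bd
    ... | e , a<c | e' , _ =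
      nested c d (≤-<-trans z≤n a<c) c<d (i≤n b d bd) (subst (_< c) (sym e) a<c)
        (subst₂ _≤_ (sym e) (sym e') (<⇒≤ a<b)) (subst (_≤ c) (sym e') (<⇒≤ b<c))

  Encodes⇒partner : ∀ {Δ q} → Encodes Δ q → Bounded q 0 → Agree (partner Δ) q
  Encodes⇒partner {Δ} {q} encodes bounded t 1≤t t≤n with m≤n⇒m<n∨m≡n (proj₂ (bounded t 1≤t t≤n))
  ... | inj₁ qt<t =
    sym (proj₁ (Equivalence.to (encodes (partner Δ t) t 1≤t t≤n)
                  (partner-arc Δ {q t} (Equivalence.from (encodes (q t) t 1≤t t≤n) (refl , qt<t)))))
  ... | inj₂ qt≡t with partner-cases Δ t
  ...   | inj₁ p≡t = trans p≡t (sym qt≡t)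
  ...   | inj₂ a with Equivalence.to (encodes (partner Δ t) t 1≤t t≤n) a
  ...     | e , p<t = ⊥-elim (<-irrefl qt≡t (subst (_< t) (sym e) p<t))

  isArc? : ∀ (q : ℕ → ℕ) j i → Dec (q i ≡ j × j < i)
  isArc? q j i = (q i ≟ j) ×-dec (j <? i)

  diagram : (ℕ → ℕ) → ArcDiagram n
  diagram q = tabulate λ a → tabulate λ b → does (isArc? q (suc (toℕ a)) (suc (toℕ b)))

  arc-diagram : ∀ q {j i} → j < n → i < n → arc (diagram q) (suc j) (suc i) ≡ does (isArc? q (suc j) (suc i))
  arc-diagram q {j} {i} j<n i<n =
    trans (arc-nth (diagram q) (nth-toList-tabulate (λ a → tabulate λ b → does (isArc? q (suc a) (suc (toℕ b)))) j j<n))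
          (cong (fromMaybe false) (nth-toList-tabulate {m = n} (λ b → does (isArc? q (suc j) (suc b))) i i<n))

  diagram-Encodes : ∀ {q} → Bounded q 0 → Encodes (diagram q) q
  diagram-Encodes {q} bounded zero i 1≤i i≤n =
    mk⇔ (λ ()) (λ (e , _) → case subst (1 ≤_) e (proj₁ (bounded i 1≤i i≤n)) of λ ())
  diagram-Encodes {q} bounded (suc j) (suc i) _ i<n with j <? n
  ... | yes j<n = subst (λ b → b ≡ true ⇔ _) (sym (arc-diagram q j<n i<n)) (does⇔ (isArc? q (suc j) (suc i)))
  ... | no j≮n = mk⇔ (λ a → ⊥-elim (j≮n (proj₁ (proj₂ (arc-range (diagram q) (suc j) (suc i) a)))))
                     (λ (_ , j<i) → ⊥-elim (j≮n (<-trans (s≤s⁻¹ j<i) i<n)))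

  pref-Ψ : ∀ Δ → Agree (pref (Ψ Δ)) (partner Δ)
  pref-Ψ Δ t 1≤t t≤n =
    trans (cong (fromMaybe 0) (nth-toList-tabulate (λ x → partner Δ (n ∸ x)) (n ∸ t) (∸-monoʳ-< 1≤t t≤n)))
          (cong (partner Δ) (m∸[m∸n]≡n t≤n))

  pref-lookup : ∀ p (k : Fin n) → pref p (n ∸ toℕ k) ≡ lookup p k
  pref-lookup p k = trans (cong (λ m → fromMaybe 0 (nth m (toList p))) (m∸[m∸n]≡n (<⇒≤ (toℕ<n k))))
                          (cong (fromMaybe 0) (nth-lookup p k))

  Ψ-pref : ∀ {Δ p} → Agree (partner Δ) (pref p) → Ψ Δ ≡ p
  Ψ-pref {Δ} {p} agree = lookup-ext λ k → begin
    lookup (Ψ Δ) k               ≡⟨ lookup∘tabulate _ k ⟩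
    partner Δ (n ∸ toℕ k)        ≡⟨ agree (n ∸ toℕ k) (m<n⇒0<n∸m (toℕ<n k)) (m∸n≤m n (toℕ k)) ⟩
    pref p (n ∸ toℕ k)           ≡⟨ pref-lookup p k ⟩
    lookup p k                   ∎
    where open ≡-Reasoning

  decStreet-parks : All (λ c → just c ∈ map just (dec n)) (map suc (upTo n))
  decStreet-parks = All.tabulate λ c∈ → case ∈-map⁻ suc c∈ of λ
    { (c , c∈upTo , refl) → ∈-map⁺ just (∈-dec (s≤s z≤n) (∈-upTo⁻ c∈upTo)) }

  matching⇒fibre : ∀ {Δ} → IsNonCrossingMatching Δ → InDecFibre n (Ψ Δ)
  matching⇒fibre {Δ} matching =
    (inRange , subst (λ st → All (λ c → just c ∈ st) (map suc (upTo n))) (sym final) decStreet-parks) , final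
    where
    agree : Agree (partner Δ) (pref (Ψ Δ))
    agree t 1≤t t≤n = sym (pref-Ψ Δ t 1≤t t≤n)

    final : finalStreet n (Ψ Δ) ≡ map just (dec n)
    final = Run.Nested∧Bounded⇒dec (Ψ Δ) (Nested-cong agree (partner-Nested matching))
                                         (Bounded-cong agree (partner-Bounded matching))

    partner-InRange : ∀ (k : Fin n) → InRange (partner Δ (n ∸ toℕ k))
    partner-InRange k with partner-Bounded matching (n ∸ toℕ k) (m<n⇒0<n∸m (toℕ<n k)) (m∸n≤m n (toℕ k))
    ... | 1≤p , p≤t = 1≤p , ≤-trans p≤t (m∸n≤m n (toℕ k))

    inRange : IsPreference n (Ψ Δ)
    inRange = All-toList-tabulate (λ k → partner Δ (n ∸ toℕ k)) partner-InRange

  Ψ-injective : ∀ {Δ Δ'} → IsNonCrossingMatching Δ → IsNonCrossingMatching Δ' → Ψ Δ ≡ Ψ Δ' → Δ ≡ Δ'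
  Ψ-injective {Δ} {Δ'} matching matching' Ψ≡ =
    Encodes-unique (matching-Encodes matching) (Encodes-cong agree (matching-Encodes matching'))
    where
    agree : Agree (partner Δ') (partner Δ)
    agree t 1≤t t≤n =
      trans (sym (pref-Ψ Δ' t 1≤t t≤n)) (trans (cong (λ p → pref p t) (sym Ψ≡)) (pref-Ψ Δ t 1≤t t≤n))

  fibre⇒matching : ∀ {p} → InDecFibre n p → ∃[ Δ ] (IsNonCrossingMatching Δ × Ψ Δ ≡ p)
  fibre⇒matching {p} ((inRange , _) , final) =
    diagram (pref p) , Encodes⇒matching encodes nested , Ψ-pref (Encodes⇒partner encodes bounded)
    where
    conditions : Nested (pref p) 0 × Bounded (pref p) 0
    conditions = Run.dec⇒Nested∧Bounded p inRange final

    nested : Nested (pref p) 0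
    nested = proj₁ conditions

    bounded : Bounded (pref p) 0
    bounded = proj₂ conditions

    encodes : Encodes (diagram (pref p)) (pref p)
    encodes = diagram-Encodes bounded

theorem3p6 : (n : ℕ) → 1 ≤ n →
    (∀ (Δ : ArcDiagram n) → IsNonCrossingMatching Δ → InDecFibre n (Ψ Δ))
    × (∀ (Δ Δ' : ArcDiagram n) → IsNonCrossingMatching Δ → IsNonCrossingMatching Δ' →
         Ψ Δ ≡ Ψ Δ' → Δ ≡ Δ')
    × (∀ (p : Vec ℕ n) → InDecFibre n p →
         ∃[ Δ ] (IsNonCrossingMatching Δ × Ψ Δ ≡ p))
theorem3p6 n _ = (λ _ → matching⇒fibre) , (λ _ _ → Ψ-injective) , (λ _ → fibre⇒matching)
  where open Matchings n
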